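{- Let $A$ be a real $n\times n$ matrix and $B$ a real $m\times m$ matrix. If $x\in\mathbb{R}^n$ satisfies $Ax=\lambda x$ and $\mathbf{1}_n^\top x=0$, then $(A\diamond B)(x\diamond \mathbf{0}_m)=m\lambda\,(x\diamond \mathbf{0}_m)$. Also, if $y\in\mathbb{R}^m$ satisfies $By=\mu y$ and $\mathbf{1}_m^\top y=0$, then $(A\diamond B)(\mathbf{0}_n\diamond y)=n\mu\,(\mathbf{0}_n\diamond y)$.
   Context: $J_k$ is the $k\times k$ all-ones matrix, $\mathbf{1}_k$ the all-ones column vector and $\mathbf{0}_k$ the zero column vector in $\mathbb{R}^k$; $\otimes$ is the Kronecker product. For an $n\times n$ matrix $A$ and an $m\times m$ matrix $B$, $A\diamond B=A\otimes J_m+J_n\otimes B$ (the $nm\times nm$ block matrix whose $(i,j)$ block is $a_{ij}J_m+B$), and for $x\in\mathbb{R}^n$, $y\in\mathbb{R}^m$, $x\diamond y=x\otimes \mathbf{1}_m+\mathbf{1}_n\otimes y$. -}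

module Defs where

open import Level using (Level)
open import Data.Nat using (ℕ) renaming (_*_ to _*ℕ_)
open import Data.Fin using (Fin; remQuot)
open import Data.Product using (proj₁; proj₂)
open import Algebra.Bundles using (CommutativeRing)
import Algebra.Definitions.RawMonoid as RM

-- Linear algebra over a commutative ring R (the paper's case is R = ℝ).
-- Vectors in R^n are functions Fin n → R, n×n matrices are Fin n → Fin n → R.
module LinAlg {c ℓ : Level} (R : CommutativeRing c ℓ) where
  open CommutativeRing R

  Vec : ℕ → Set c
  Vec n = Fin n → Carrier

  Mat : ℕ → Set c
  Mat n = Fin n → Fin n → Carrier

  ∑ : ∀ {n} → Vec n → Carrier
  ∑ = RM.sum +-rawMonoid

  _·_ : ℕ → Carrier → Carrier
  _·_ = RM._×_ +-rawMonoid

  _*ᵥ_ : ∀ {n} → Mat n → Vec n → Vec n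
  (A *ᵥ x) i = ∑ (λ j → A i j * x j)

  _∙ᵥ_ : ∀ {n} → Carrier → Vec n → Vec n
  (r ∙ᵥ x) i = r * x i

  _≋_ : ∀ {n} → Vec n → Vec n → Set ℓ
  x ≋ y = ∀ i → x i ≈ y i

  𝟏 : ∀ k → Vec k
  𝟏 k _ = 1#

  𝟎 : ∀ k → Vec k
  𝟎 k _ = 0#

  J : ∀ k → Mat k
  J k _ _ = 1#

  -- Kronecker products. Index i·m + j of R^{nm} (0-based) corresponds to the
  -- pair (i , j) via Data.Fin.remQuot / combine.
  _⊗ₘ_ : ∀ {n m} → Mat n → Mat m → Mat (n *ℕ m)
  _⊗ₘ_ {n} {m} A B p q =
    A (proj₁ (remQuot m p)) (proj₁ (remQuot m q)) *
    B (proj₂ (remQuot {n} m p)) (proj₂ (remQuot {n} m q))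

  _⊗ᵥ_ : ∀ {n m} → Vec n → Vec m → Vec (n *ℕ m)
  _⊗ᵥ_ {n} {m} x y p = x (proj₁ (remQuot m p)) * y (proj₂ (remQuot {n} m p))

  _◇ₘ_ : ∀ {n m} → Mat n → Mat m → Mat (n *ℕ m)
  _◇ₘ_ {n} {m} A B p q = (A ⊗ₘ J m) p q + (J n ⊗ₘ B) p q

  _◇ᵥ_ : ∀ {n m} → Vec n → Vec m → Vec (n *ℕ m)
  _◇ᵥ_ {n} {m} x y p = (x ⊗ᵥ 𝟏 m) p + (𝟏 n ⊗ᵥ y) p

module Submission where

open import Defs
open import Level using (Level)
open import Data.Nat using (ℕ; zero; suc) renaming (_*_ to _*ℕ_; _+_ to _+ℕ_)
open import Data.Product using (_×_; _,_)
open import Data.Fin using (Fin; zero; suc; _↑ˡ_; _↑ʳ_; combine; quotient; remainder)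
open import Data.Fin.Properties using (remQuot-combine)
open import Algebra.Bundles using (CommutativeRing)
import Algebra.Properties.Semiring.Sum as SemiringSum
import Algebra.Properties.Semiring.Mult as SemiringMult
import Relation.Binary.Reasoning.Setoid as SetoidReasoning
open import Relation.Binary.PropositionalEquality using (cong)

-- With the index of R^{nm} read as a pair (i , j), the (i , j) entry of (A ◇ B)(x ◇ y) is
--   ∑_{a,b} (A i a + B j b)(x a + y b) = m (A x)_i + (∑ A i)(∑ y) + (∑ B j)(∑ x) + n (B y)_j.
-- For y = 0 and 1ᵀx = 0 only the first term survives, and it is m λ x_i; symmetrically for x = 0.

module DiamondProperties {c ℓ : Level} (R : CommutativeRing c ℓ) where
  open CommutativeRing R
  open LinAlg R
  open SemiringSum semiring
  open SemiringMult semiring using (×-congʳ; ×-assoc-*)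
  open SetoidReasoning setoid

  ∑-splitAt : ∀ a b (f : Vec (a +ℕ b)) →
              ∑ f ≈ ∑ (λ i → f (i ↑ˡ b)) + ∑ (λ i → f (a ↑ʳ i))
  ∑-splitAt zero    b f = sym (+-identityˡ _)
  ∑-splitAt (suc a) b f = trans (+-congˡ (∑-splitAt a b (λ i → f (suc i)))) (sym (+-assoc _ _ _))

  ∑-combine : ∀ n m (f : Vec (n *ℕ m)) → ∑ f ≈ ∑ {n} (λ i → ∑ {m} (λ j → f (combine i j)))
  ∑-combine zero    m f = refl
  ∑-combine (suc n) m f =
    trans (∑-splitAt m (n *ℕ m) f) (+-congˡ (∑-combine n m (λ q → f (m ↑ʳ q))))

  ∑-remQuot : ∀ n m (h : Fin n → Fin m → Carrier) →
              ∑ (λ p → h (quotient m p) (remainder {n} m p)) ≈ ∑ (λ i → ∑ (h i))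
  ∑-remQuot n m h = trans (∑-combine n m _) (reflexive
    (sum-cong-≗ {n} (λ i → sum-cong-≗ {m} (λ j → cong (λ (i′ , j′) → h i′ j′) (remQuot-combine i j)))))

  ∑∑-distrib-+ : ∀ {n m} (f g : Fin n → Fin m → Carrier) →
                 ∑ (λ a → ∑ (λ b → f a b + g a b)) ≈ ∑ (λ a → ∑ (f a)) + ∑ (λ a → ∑ (g a))
  ∑∑-distrib-+ {n} f g = trans (sum-cong-≋ (λ a → ∑-distrib-+ (f a) (g a))) (∑-distrib-+ {n} _ _)

  ∑∑-* : ∀ {n m} (u : Vec n) (v : Vec m) → ∑ (λ a → ∑ (λ b → u a * v b)) ≈ ∑ u * ∑ v
  ∑∑-* u v = begin
    ∑ (λ a → ∑ (λ b → u a * v b)) ≈⟨ sum-cong-≋ (λ a → sym (*-distribˡ-sum (u a) v)) ⟩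
    ∑ (λ a → u a * ∑ v)           ≈⟨ sym (*-distribʳ-sum (∑ v) u) ⟩
    ∑ u * ∑ v                     ∎

  ∑-𝟏-* : ∀ {k} (x : Vec k) → ∑ (λ i → 𝟏 k i * x i) ≈ ∑ x
  ∑-𝟏-* x = sum-cong-≋ (λ i → *-identityˡ (x i))

  *ᵥ-𝟎 : ∀ {k} (A : Mat k) i → (A *ᵥ 𝟎 k) i ≈ 0#
  *ᵥ-𝟎 {k} A i = trans (sum-cong-≋ (λ j → zeroʳ (A i j))) (sum-replicate-zero k)

  ·-zeroʳ : ∀ k → k · 0# ≈ 0#
  ·-zeroʳ k = trans (sym (sum-replicate k)) (sum-replicate-zero k)

  *1+1* : ∀ u v → u * 1# + 1# * v ≈ u + v
  *1+1* u v = +-cong (*-identityʳ u) (*-identityˡ v)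

  ◇-entry : ∀ a b x y → (a * 1# + 1# * b) * (x * 1# + 1# * y) ≈ (a * x + a * y) + (b * x + b * y)
  ◇-entry a b x y = begin
    (a * 1# + 1# * b) * (x * 1# + 1# * y) ≈⟨ *-cong (*1+1* a b) (*1+1* x y) ⟩
    (a + b) * (x + y)                     ≈⟨ distribʳ (x + y) a b ⟩
    a * (x + y) + b * (x + y)             ≈⟨ +-cong (distribˡ a x y) (distribˡ b x y) ⟩
    (a * x + a * y) + (b * x + b * y)     ∎

  ◇ₘ-*ᵥ-◇ᵥ : ∀ {n m} (A : Mat n) (B : Mat m) (x : Vec n) (y : Vec m) p →
    let i = quotient m p; j = remainder {n} m p in
    ((A ◇ₘ B) *ᵥ (x ◇ᵥ y)) p ≈ (m · (A *ᵥ x) i + ∑ (A i) * ∑ y) + (∑ (B j) * ∑ x + n · (B *ᵥ y) j)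
  ◇ₘ-*ᵥ-◇ᵥ {n} {m} A B x y p = begin
    ((A ◇ₘ B) *ᵥ (x ◇ᵥ y)) p
      ≈⟨ ∑-remQuot n m (λ a b → (A i a * 1# + 1# * B j b) * (x a * 1# + 1# * y b)) ⟩
    ∑ (λ a → ∑ (λ b → (A i a * 1# + 1# * B j b) * (x a * 1# + 1# * y b)))
      ≈⟨ sum-cong-≋ (λ a → sum-cong-≋ (λ b → ◇-entry (A i a) (B j b) (x a) (y b))) ⟩
    ∑ (λ a → ∑ (λ b → (A i a * x a + A i a * y b) + (B j b * x a + B j b * y b)))
      ≈⟨ trans (∑∑-distrib-+ {n} {m} _ _)
               (+-cong (∑∑-distrib-+ {n} {m} _ _) (∑∑-distrib-+ {n} {m} _ _)) ⟩
    (∑ (λ a → ∑ {m} (λ b → A i a * x a)) + ∑ (λ a → ∑ (λ b → A i a * y b)))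
      + (∑ (λ a → ∑ (λ b → B j b * x a)) + ∑ {n} (λ a → ∑ (λ b → B j b * y b)))
      ≈⟨ +-cong (+-cong (trans (∑-comm {n} {m} _) (sum-replicate m)) (∑∑-* (A i) y))
                (+-cong (trans (∑-comm {n} {m} _) (∑∑-* (B j) x)) (sum-replicate n)) ⟩
    (m · (A *ᵥ x) i + ∑ (A i) * ∑ y) + (∑ (B j) * ∑ x + n · (B *ᵥ y) j)
      ∎
    where
    i = quotient m p
    j = remainder {n} m p

  ◇ᵥ-𝟎ʳ : ∀ {n m} (x : Vec n) p → (x ◇ᵥ 𝟎 m) p ≈ x (quotient m p)
  ◇ᵥ-𝟎ʳ x p = trans (*1+1* _ _) (+-identityʳ _)

  ◇ᵥ-𝟎ˡ : ∀ {n m} (y : Vec m) p → (𝟎 n ◇ᵥ y) p ≈ y (remainder {n} m p)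
  ◇ᵥ-𝟎ˡ y p = trans (*1+1* _ _) (+-identityˡ _)

  ◇ₘ-eigenˡ : ∀ {n m} (A : Mat n) (B : Mat m) (x : Vec n) λ' →
              (A *ᵥ x) ≋ (λ' ∙ᵥ x) → ∑ x ≈ 0# →
              ((A ◇ₘ B) *ᵥ (x ◇ᵥ 𝟎 m)) ≋ ((m · λ') ∙ᵥ (x ◇ᵥ 𝟎 m))
  ◇ₘ-eigenˡ {n} {m} A B x λ' Ax≈λx ∑x≈0 p = begin
    ((A ◇ₘ B) *ᵥ (x ◇ᵥ 𝟎 m)) p
      ≈⟨ ◇ₘ-*ᵥ-◇ᵥ A B x (𝟎 m) p ⟩
    (m · (A *ᵥ x) i + ∑ (A i) * ∑ (𝟎 m)) + (∑ (B j) * ∑ x + n · (B *ᵥ 𝟎 m) j)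
      ≈⟨ +-cong (+-cong (×-congʳ m (Ax≈λx i)) (trans (*-congˡ (sum-replicate-zero m)) (zeroʳ _)))
                (+-cong (trans (*-congˡ ∑x≈0) (zeroʳ _)) (trans (×-congʳ n (*ᵥ-𝟎 B j)) (·-zeroʳ n))) ⟩
    (m · (λ' * x i) + 0#) + (0# + 0#)
      ≈⟨ trans (+-cong (+-identityʳ _) (+-identityʳ 0#)) (+-identityʳ _) ⟩
    m · (λ' * x i)
      ≈⟨ ×-assoc-* m λ' (x i) ⟨
    (m · λ') * x i
      ≈⟨ *-congˡ (◇ᵥ-𝟎ʳ x p) ⟨
    (m · λ') * (x ◇ᵥ 𝟎 m) p
      ∎
    where
    i = quotient m p
    j = remainder {n} m p

  ◇ₘ-eigenʳ : ∀ {n m} (A : Mat n) (B : Mat m) (y : Vec m) μ →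
              (B *ᵥ y) ≋ (μ ∙ᵥ y) → ∑ y ≈ 0# →
              ((A ◇ₘ B) *ᵥ (𝟎 n ◇ᵥ y)) ≋ ((n · μ) ∙ᵥ (𝟎 n ◇ᵥ y))
  ◇ₘ-eigenʳ {n} {m} A B y μ By≈μy ∑y≈0 p = begin
    ((A ◇ₘ B) *ᵥ (𝟎 n ◇ᵥ y)) p
      ≈⟨ ◇ₘ-*ᵥ-◇ᵥ A B (𝟎 n) y p ⟩
    (m · (A *ᵥ 𝟎 n) i + ∑ (A i) * ∑ y) + (∑ (B j) * ∑ (𝟎 n) + n · (B *ᵥ y) j)
      ≈⟨ +-cong (+-cong (trans (×-congʳ m (*ᵥ-𝟎 A i)) (·-zeroʳ m)) (trans (*-congˡ ∑y≈0) (zeroʳ _)))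
                (+-cong (trans (*-congˡ (sum-replicate-zero n)) (zeroʳ _)) (×-congʳ n (By≈μy j))) ⟩
    (0# + 0#) + (0# + n · (μ * y j))
      ≈⟨ trans (+-cong (+-identityʳ 0#) (+-identityˡ _)) (+-identityˡ _) ⟩
    n · (μ * y j)
      ≈⟨ ×-assoc-* n μ (y j) ⟨
    (n · μ) * y j
      ≈⟨ *-congˡ (◇ᵥ-𝟎ˡ {n} y p) ⟨
    (n · μ) * (𝟎 n ◇ᵥ y) p
      ∎
    where
    i = quotient m p
    j = remainder {n} m p

mainTheorem4 : {c ℓ : Level} (R : CommutativeRing c ℓ) →
    let open CommutativeRing R in
    let open LinAlg R in
    (n m : ℕ) (A : Mat n) (B : Mat m) →
      ((x : Vec n) (λ' : Carrier) → (A *ᵥ x) ≋ (λ' ∙ᵥ x) → ∑ (λ i → 𝟏 n i * x i) ≈ 0# →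
        ((A ◇ₘ B) *ᵥ (x ◇ᵥ 𝟎 m)) ≋ ((m · λ') ∙ᵥ (x ◇ᵥ 𝟎 m)))
      ×
      ((y : Vec m) (μ : Carrier) → (B *ᵥ y) ≋ (μ ∙ᵥ y) → ∑ (λ i → 𝟏 m i * y i) ≈ 0# →
        ((A ◇ₘ B) *ᵥ (𝟎 n ◇ᵥ y)) ≋ ((n · μ) ∙ᵥ (𝟎 n ◇ᵥ y)))
mainTheorem4 R n m A B =
    (λ x λ' eigen 𝟏ᵀx≈0 → ◇ₘ-eigenˡ A B x λ' eigen (trans (sym (∑-𝟏-* x)) 𝟏ᵀx≈0))
  , (λ y μ eigen 𝟏ᵀy≈0 → ◇ₘ-eigenʳ A B y μ eigen (trans (sym (∑-𝟏-* y)) 𝟏ᵀy≈0))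
  where
  open CommutativeRing R using (sym; trans)
  open DiamondProperties R
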